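{- The numbers of edges of the graphs $\overline{\Gamma}_n$ satisfy $|E(\overline{\Gamma}_1)|=|E(\overline{\Gamma}_2)|=0$ and, for $n\geq 3$, $$|E(\overline{\Gamma}_n)|=|E(\overline{\Gamma}_{n-1})|+|E(\overline{\Gamma}_{n-2})|+(n+4)2^{n-3}-F_{n+2}.$$
   Context: The hypercube $Q_n$ has vertex set the binary strings of length $n$, adjacency meaning differing in exactly one position. $\overline{\Gamma}_n$ (the cube-complement of the Fibonacci cube) is the subgraph of $Q_n$ induced by the binary strings of length $n$ containing $11$ as a substring. $F_n$ is the Fibonacci sequence $F_0=0$, $F_1=1$, $F_n=F_{n-1}+F_{n-2}$. -}

module Defs where

open import Data.Nat using (ℕ; zero; suc; _+_; _*_)
open import Data.Bool using (Bool; true; false; _∧_; _∨_; not; _xor_; if_then_else_)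
open import Data.Product using (_×_; _,_; proj₁; proj₂)
open import Data.Vec using (Vec; []; _∷_)
open import Data.List using (List; []; _∷_; _++_; map; concatMap; filterᵇ; length)

fib : ℕ → ℕ
fib zero = zero
fib (suc zero) = suc zero
fib (suc (suc n)) = fib (suc n) + fib n

allStrings : (n : ℕ) → List (Vec Bool n)
allStrings zero = [] ∷ []
allStrings (suc n) = map (false ∷_) (allStrings n) ++ map (true ∷_) (allStrings n)

has11 : {n : ℕ} → Vec Bool n → Bool
has11 [] = false
has11 (x ∷ []) = false
has11 (x ∷ y ∷ xs) = (x ∧ y) ∨ has11 (y ∷ xs)

hamming : {n : ℕ} → Vec Bool n → Vec Bool n → ℕ
hamming [] [] = zero
hamming (x ∷ xs) (y ∷ ys) = (if x xor y then 1 else 0) + hamming xs ys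

adjacentᵇ : {n : ℕ} → Vec Bool n → Vec Bool n → Bool
adjacentᵇ u v with hamming u v
... | suc zero = true
... | _ = false

-- strict lexicographic order (false < true), used to count each unordered edge once
lexLtᵇ : {n : ℕ} → Vec Bool n → Vec Bool n → Bool
lexLtᵇ [] [] = false
lexLtᵇ (false ∷ xs) (true ∷ ys) = true
lexLtᵇ (true ∷ xs) (false ∷ ys) = false
lexLtᵇ (x ∷ xs) (y ∷ ys) = lexLtᵇ xs ys

-- vertex set of the cube-complement of the Fibonacci cube
vertsΓbar : (n : ℕ) → List (Vec Bool n)
vertsΓbar n = filterᵇ has11 (allStrings n)

edgesΓbar : (n : ℕ) → List (Vec Bool n × Vec Bool n)
edgesΓbar n = filterᵇ (λ p → adjacentᵇ (proj₁ p) (proj₂ p) ∧ lexLtᵇ (proj₁ p) (proj₂ p))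
                (concatMap (λ u → map (u ,_) (vertsΓbar n)) (vertsΓbar n))

numEdges : ℕ → ℕ
numEdges n = length (edgesΓbar n)

-- Split Q_{n+1} into the halves 0Q_n and 1Q_n: the edges of an induced subgraph
-- are those inside each half plus the matching edges 0u–1u with both ends present.
-- For Γ̄ the 0-half is Γ̄_n, and the matching contributes one edge per vertex of Γ̄_n.
-- The 1-half is induced by the strings u for which 1u contains 11; splitting it once more gives
-- Γ̄_{n-1} (prefix 10), the whole cube Q_{n-1} (prefix 11) and again a matching of
-- size |V(Γ̄_{n-1})|. Writing e_n, g_n for the edge and vertex counts of Γ̄_n,
-- e_{n+1} = e_n + e_{n-1} + g_n + g_{n-1} + (n-1)2^{n-2},
-- and the vertex counts g_n = 2^n − F_{n+2} turn this into the stated recurrence.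
module Submission where

open import Defs
open import Data.Nat using (ℕ; zero; suc; _+_; _*_; _^_)
open import Data.Nat.Properties using (+-comm; +-identityʳ)
open import Data.Nat.ListAction using (sum)
open import Data.Nat.ListAction.Properties using (sum-++)
open import Data.Nat.Tactic.RingSolver using (solve-∀)
open import Data.Bool using (Bool; true; false; _∧_; if_then_else_)
open import Data.Bool.Properties using (∧-identityʳ; ∧-zeroʳ; ∨-zeroʳ)
open import Data.Product using (_×_; _,_; proj₁; proj₂)
open import Data.Vec using (Vec; []; _∷_)
open import Data.List using (List; []; _∷_; _++_; map; concatMap; filterᵇ; length)
open import Data.List.Properties using (map-++; map-∘; map-cong)
open import Function using (_∘_)
open import Relation.Binary.PropositionalEquality
  using (_≡_; refl; sym; trans; cong; cong₂; module ≡-Reasoning)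
open ≡-Reasoning

infixr 7 [_]·_

[_]·_ : Bool → ℕ → ℕ
[ b ]· x = if b then x else 0

[]·-∧ : ∀ a b x → [ a ]· [ b ]· x ≡ [ a ∧ b ]· x
[]·-∧ true  b x = refl
[]·-∧ false b x = refl

[]·-+ : ∀ b x y → [ b ]· (x + y) ≡ [ b ]· x + [ b ]· y
[]·-+ true  x y = refl
[]·-+ false x y = refl

[]·-0 : ∀ b → [ b ]· 0 ≡ 0
[]·-0 true  = refl
[]·-0 false = refl

module _ {A : Set} where

  length-filterᵇ : (p : A → Bool) (xs : List A) →
                   length (filterᵇ p xs) ≡ sum (map (λ x → [ p x ]· 1) xs)
  length-filterᵇ p []       = refl
  length-filterᵇ p (x ∷ xs) with p x
  ... | true  = cong suc (length-filterᵇ p xs)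
  ... | false = length-filterᵇ p xs

  sum-map-filterᵇ : (p : A → Bool) (f : A → ℕ) (xs : List A) →
                    sum (map f (filterᵇ p xs)) ≡ sum (map (λ x → [ p x ]· f x) xs)
  sum-map-filterᵇ p f []       = refl
  sum-map-filterᵇ p f (x ∷ xs) with p x
  ... | true  = cong (f x +_) (sum-map-filterᵇ p f xs)
  ... | false = sum-map-filterᵇ p f xs

  sum-map-concatMap : {B : Set} (f : B → ℕ) (g : A → List B) (xs : List A) →
                      sum (map f (concatMap g xs)) ≡ sum (map (sum ∘ map f ∘ g) xs)
  sum-map-concatMap f g []       = refl
  sum-map-concatMap f g (x ∷ xs) = begin
    sum (map f (g x ++ concatMap g xs))
      ≡⟨ cong sum (map-++ f (g x) (concatMap g xs)) ⟩
    sum (map f (g x) ++ map f (concatMap g xs))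
      ≡⟨ sum-++ (map f (g x)) _ ⟩
    sum (map f (g x)) + sum (map f (concatMap g xs))
      ≡⟨ cong (sum (map f (g x)) +_) (sum-map-concatMap f g xs) ⟩
    sum (map f (g x)) + sum (map (sum ∘ map f ∘ g) xs) ∎

∑ : (n : ℕ) → (Vec Bool n → ℕ) → ℕ
∑ zero    f = f []
∑ (suc n) f = ∑ n (f ∘ (false ∷_)) + ∑ n (f ∘ (true ∷_))

sum-map-allStrings : (n : ℕ) (f : Vec Bool n → ℕ) → sum (map f (allStrings n)) ≡ ∑ n f
sum-map-allStrings zero    f = +-identityʳ (f [])
sum-map-allStrings (suc n) f = begin
  sum (map f (map (false ∷_) vs ++ map (true ∷_) vs))
    ≡⟨ cong sum (map-++ f (map (false ∷_) vs) _) ⟩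
  sum (map f (map (false ∷_) vs) ++ map f (map (true ∷_) vs))
    ≡⟨ sum-++ (map f (map (false ∷_) vs)) _ ⟩
  sum (map f (map (false ∷_) vs)) + sum (map f (map (true ∷_) vs))
    ≡⟨ cong₂ _+_ (half false) (half true) ⟩
  ∑ (suc n) f ∎
  where
  vs = allStrings n
  half : ∀ b → sum (map f (map (b ∷_) vs)) ≡ ∑ n (f ∘ (b ∷_))
  half b = trans (cong sum (sym (map-∘ vs))) (sum-map-allStrings n (f ∘ (b ∷_)))

∑-cong : ∀ n {f g : Vec Bool n → ℕ} → (∀ u → f u ≡ g u) → ∑ n f ≡ ∑ n g
∑-cong zero    f≗g = f≗g []
∑-cong (suc n) f≗g = cong₂ _+_ (∑-cong n (f≗g ∘ (false ∷_))) (∑-cong n (f≗g ∘ (true ∷_)))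

∑-0 : ∀ n {f : Vec Bool n → ℕ} → (∀ u → f u ≡ 0) → ∑ n f ≡ 0
∑-0 zero    f≗0 = f≗0 []
∑-0 (suc n) f≗0 = cong₂ _+_ (∑-0 n (f≗0 ∘ (false ∷_))) (∑-0 n (f≗0 ∘ (true ∷_)))

∑-+ : ∀ n (f g : Vec Bool n → ℕ) → ∑ n (λ u → f u + g u) ≡ ∑ n f + ∑ n g
∑-+ zero    f g = refl
∑-+ (suc n) f g = begin
  ∑ n (λ u → f (false ∷ u) + g (false ∷ u)) + ∑ n (λ u → f (true ∷ u) + g (true ∷ u))
    ≡⟨ cong₂ _+_ (∑-+ n _ _) (∑-+ n _ _) ⟩
  (∑ n (f ∘ (false ∷_)) + ∑ n (g ∘ (false ∷_))) + (∑ n (f ∘ (true ∷_)) + ∑ n (g ∘ (true ∷_)))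
    ≡⟨ interchange (∑ n (f ∘ (false ∷_))) (∑ n (g ∘ (false ∷_))) (∑ n (f ∘ (true ∷_))) _ ⟩
  ∑ (suc n) f + ∑ (suc n) g ∎
  where
  interchange : ∀ a b c d → (a + b) + (c + d) ≡ (a + c) + (b + d)
  interchange = solve-∀

∑-1 : ∀ n → ∑ n (λ _ → 1) ≡ 2 ^ n
∑-1 zero    = refl
∑-1 (suc n) = trans (cong₂ _+_ (∑-1 n) (∑-1 n)) (cong (2 ^ n +_) (sym (+-identityʳ (2 ^ n))))

count : (n : ℕ) → (Vec Bool n → Bool) → ℕ
count n P = ∑ n (λ u → [ P u ]· 1)

isEdge : {n : ℕ} → Vec Bool n → Vec Bool n → Bool
isEdge u v = adjacentᵇ u v ∧ lexLtᵇ u v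

edgeCount : (n : ℕ) → (Vec Bool n → Bool) → ℕ
edgeCount n P = ∑ n (λ u → [ P u ]· ∑ n (λ v → [ P v ]· [ isEdge u v ]· 1))

edgeCount-cong : ∀ n {P Q : Vec Bool n → Bool} → (∀ u → P u ≡ Q u) → edgeCount n P ≡ edgeCount n Q
edgeCount-cong n P≗Q =
  ∑-cong n (λ u → cong₂ [_]·_ (P≗Q u) (∑-cong n (λ v → cong₂ [_]·_ (P≗Q v) refl)))

numEdges≡edgeCount : ∀ n → numEdges n ≡ edgeCount n has11
numEdges≡edgeCount n = begin
  length (filterᵇ edge (concatMap pairsFrom V))
    ≡⟨ length-filterᵇ edge (concatMap pairsFrom V) ⟩
  sum (map indicator (concatMap pairsFrom V))
    ≡⟨ sum-map-concatMap indicator pairsFrom V ⟩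
  sum (map (sum ∘ map indicator ∘ pairsFrom) V)
    ≡⟨ cong sum (map-cong neighbours V) ⟩
  sum (map (λ u → ∑ n (λ v → [ has11 v ]· [ isEdge u v ]· 1)) V)
    ≡⟨ sum-map-filterᵇ has11 _ (allStrings n) ⟩
  sum (map (λ u → [ has11 u ]· ∑ n (λ v → [ has11 v ]· [ isEdge u v ]· 1)) (allStrings n))
    ≡⟨ sum-map-allStrings n _ ⟩
  edgeCount n has11 ∎
  where
  V = vertsΓbar n
  pairsFrom : Vec Bool n → List (Vec Bool n × Vec Bool n)
  pairsFrom u = map (u ,_) V
  edge : Vec Bool n × Vec Bool n → Bool
  edge p = isEdge (proj₁ p) (proj₂ p)
  indicator : Vec Bool n × Vec Bool n → ℕ
  indicator p = [ edge p ]· 1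
  neighbours : ∀ u → sum (map indicator (pairsFrom u)) ≡ ∑ n (λ v → [ has11 v ]· [ isEdge u v ]· 1)
  neighbours u = begin
    sum (map indicator (map (u ,_) V))  ≡⟨ cong sum (sym (map-∘ V)) ⟩
    sum (map (λ v → [ isEdge u v ]· 1) V) ≡⟨ sum-map-filterᵇ has11 _ (allStrings n) ⟩
    _                                    ≡⟨ sum-map-allStrings n _ ⟩
    ∑ n (λ v → [ has11 v ]· [ isEdge u v ]· 1) ∎

-- 0u and 1v are adjacent iff u = v, and then 0u <lex 1v.
∑-isEdge-matching : ∀ n (Q : Vec Bool n → Bool) (u : Vec Bool n) →
                    ∑ n (λ v → [ Q v ]· [ isEdge (false ∷ u) (true ∷ v) ]· 1) ≡ [ Q u ]· 1
∑-isEdge-matching zero    Q []          = refl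
∑-isEdge-matching (suc n) Q (false ∷ u) = begin
  _ ≡⟨ cong₂ _+_ (∑-isEdge-matching n (Q ∘ (false ∷_)) u) (∑-0 n (λ v → []·-0 (Q (true ∷ v)))) ⟩
  [ Q (false ∷ u) ]· 1 + 0 ≡⟨ +-identityʳ _ ⟩
  [ Q (false ∷ u) ]· 1 ∎
∑-isEdge-matching (suc n) Q (true ∷ u)  =
  cong₂ _+_ (∑-0 n (λ v → []·-0 (Q (false ∷ v)))) (∑-isEdge-matching n (Q ∘ (true ∷_)) u)

-- 1u <lex 0v never holds, so the 1-half contributes no edges towards the 0-half.
edgeCount-suc : ∀ n (P : Vec Bool (suc n) → Bool) →
  edgeCount (suc n) P ≡ edgeCount n (P ∘ (false ∷_))
                        + count n (λ u → P (false ∷ u) ∧ P (true ∷ u))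
                        + edgeCount n (P ∘ (true ∷_))
edgeCount-suc n P = begin
  edgeCount (suc n) P
    ≡⟨ cong₂ _+_ (∑-cong n lowerHalf) (∑-cong n upperHalf) ⟩
  ∑ n (λ u → [ P₀ u ]· inner P₀ u + [ P₀ u ∧ P₁ u ]· 1) + edgeCount n P₁
    ≡⟨ cong (_+ edgeCount n P₁) (∑-+ n _ _) ⟩
  edgeCount n P₀ + count n (λ u → P₀ u ∧ P₁ u) + edgeCount n P₁ ∎
  where
  P₀ P₁ : Vec Bool n → Bool
  P₀ = P ∘ (false ∷_)
  P₁ = P ∘ (true ∷_)
  inner : (Vec Bool n → Bool) → Vec Bool n → ℕ
  inner R u = ∑ n (λ v → [ R v ]· [ isEdge u v ]· 1)
  lowerHalf : ∀ u → [ P₀ u ]· (inner P₀ u + ∑ n (λ v → [ P₁ v ]· [ isEdge (false ∷ u) (true ∷ v) ]· 1))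
                  ≡ [ P₀ u ]· inner P₀ u + [ P₀ u ∧ P₁ u ]· 1
  lowerHalf u = begin
    _ ≡⟨ cong (λ k → [ P₀ u ]· (inner P₀ u + k)) (∑-isEdge-matching n P₁ u) ⟩
    [ P₀ u ]· (inner P₀ u + [ P₁ u ]· 1)          ≡⟨ []·-+ (P₀ u) _ _ ⟩
    [ P₀ u ]· inner P₀ u + [ P₀ u ]· [ P₁ u ]· 1 ≡⟨ cong ([ P₀ u ]· inner P₀ u +_) ([]·-∧ (P₀ u) (P₁ u) 1) ⟩
    [ P₀ u ]· inner P₀ u + [ P₀ u ∧ P₁ u ]· 1 ∎
  noEdgeDown : ∀ u v → [ P₀ v ]· [ isEdge (true ∷ u) (false ∷ v) ]· 1 ≡ 0
  noEdgeDown u v = trans (cong (λ b → [ P₀ v ]· [ b ]· 1) (∧-zeroʳ (adjacentᵇ (true ∷ u) (false ∷ v))))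
                         ([]·-0 (P₀ v))
  upperHalf : ∀ u → [ P₁ u ]· (∑ n (λ v → [ P₀ v ]· [ isEdge (true ∷ u) (false ∷ v) ]· 1) + inner P₁ u)
                  ≡ [ P₁ u ]· inner P₁ u
  upperHalf u = cong (λ k → [ P₁ u ]· (k + inner P₁ u)) (∑-0 n (noEdgeDown u))

has11-false∷ : ∀ {n} (u : Vec Bool n) → has11 (false ∷ u) ≡ has11 u
has11-false∷ []      = refl
has11-false∷ (_ ∷ _) = refl

has11-∧-true∷ : ∀ {n} (u : Vec Bool n) → has11 u ∧ has11 (true ∷ u) ≡ has11 u
has11-∧-true∷ []      = refl
has11-∧-true∷ (x ∷ u) with has11 (x ∷ u)
... | true  = ∨-zeroʳ x
... | false = refl

vertexCount edgeCountΓ̄ edgeCount1Γ̄ edgeCountQ : ℕ → ℕ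
vertexCount  n = count n has11
edgeCountΓ̄  n = edgeCount n has11
edgeCount1Γ̄ n = edgeCount n (has11 ∘ (true ∷_))
edgeCountQ   n = edgeCount n (λ _ → true)

edgeCountQ-suc : ∀ n → edgeCountQ (suc n) ≡ suc n * 2 ^ n
edgeCountQ-suc zero    = refl
edgeCountQ-suc (suc n) = begin
  edgeCountQ (suc (suc n))
    ≡⟨ edgeCount-suc (suc n) (λ _ → true) ⟩
  edgeCountQ (suc n) + ∑ (suc n) (λ _ → 1) + edgeCountQ (suc n)
    ≡⟨ cong₂ _+_ (cong₂ _+_ (edgeCountQ-suc n) (∑-1 (suc n))) (edgeCountQ-suc n) ⟩
  suc n * 2 ^ n + 2 * 2 ^ n + suc n * 2 ^ n
    ≡⟨ identity n (2 ^ n) ⟩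
  suc (suc n) * 2 ^ suc n ∎
  where
  identity : ∀ n p → suc n * p + 2 * p + suc n * p ≡ suc (suc n) * (2 * p)
  identity = solve-∀

vertexCount-suc-suc : ∀ n → vertexCount (suc (suc n)) ≡ vertexCount (suc n) + (vertexCount n + 2 ^ n)
vertexCount-suc-suc n =
  cong₂ _+_ (∑-cong (suc n) (λ u → cong ([_]· 1) (has11-false∷ u)))
            (cong₂ _+_ (∑-cong n (λ u → cong ([_]· 1) (has11-false∷ u))) (∑-1 n))

vertexCount+fib : ∀ n → vertexCount n + fib (suc (suc n)) ≡ 2 ^ n
vertexCount+fib zero          = refl
vertexCount+fib (suc zero)    = refl
vertexCount+fib (suc (suc n)) = begin
  vertexCount (suc (suc n)) + fib (4 + n)
    ≡⟨ cong (_+ fib (4 + n)) (vertexCount-suc-suc n) ⟩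
  vertexCount (suc n) + (vertexCount n + 2 ^ n) + (fib (3 + n) + fib (2 + n))
    ≡⟨ regroup (vertexCount (suc n)) (vertexCount n) (2 ^ n) (fib (3 + n)) (fib (2 + n)) ⟩
  (vertexCount (suc n) + fib (3 + n)) + (vertexCount n + fib (2 + n)) + 2 ^ n
    ≡⟨ cong₂ (λ a b → a + b + 2 ^ n) (vertexCount+fib (suc n)) (vertexCount+fib n) ⟩
  2 ^ suc n + 2 ^ n + 2 ^ n
    ≡⟨ doubling (2 ^ n) ⟩
  2 ^ suc (suc n) ∎
  where
  regroup : ∀ a b p x y → a + (b + p) + (x + y) ≡ (a + x) + (b + y) + p
  regroup = solve-∀
  doubling : ∀ p → 2 * p + p + p ≡ 2 * (2 * p)
  doubling = solve-∀

edgeCountΓ̄-suc : ∀ n → edgeCountΓ̄ (suc n) ≡ edgeCountΓ̄ n + vertexCount n + edgeCount1Γ̄ n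
edgeCountΓ̄-suc n = begin
  edgeCountΓ̄ (suc n)
    ≡⟨ edgeCount-suc n has11 ⟩
  edgeCount n (has11 ∘ (false ∷_)) + count n (λ u → has11 (false ∷ u) ∧ has11 (true ∷ u)) + edgeCount1Γ̄ n
    ≡⟨ cong₂ (λ a b → a + b + edgeCount1Γ̄ n)
             (edgeCount-cong n has11-false∷)
             (∑-cong n (λ u → cong ([_]· 1) (trans (cong (_∧ has11 (true ∷ u)) (has11-false∷ u)) (has11-∧-true∷ u)))) ⟩
  edgeCountΓ̄ n + vertexCount n + edgeCount1Γ̄ n ∎

-- has11 (true ∷ true ∷ u) is true, so the 11-prefixed half is a whole cube.
edgeCount1Γ̄-suc : ∀ n → edgeCount1Γ̄ (suc n) ≡ edgeCountΓ̄ n + vertexCount n + edgeCountQ n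
edgeCount1Γ̄-suc n = begin
  edgeCount1Γ̄ (suc n)
    ≡⟨ edgeCount-suc n (has11 ∘ (true ∷_)) ⟩
  edgeCount n (has11 ∘ (false ∷_)) + count n (λ u → has11 (false ∷ u) ∧ true) + edgeCountQ n
    ≡⟨ cong₂ (λ a b → a + b + edgeCountQ n)
             (edgeCount-cong n has11-false∷)
             (∑-cong n (λ u → cong ([_]· 1) (trans (∧-identityʳ _) (has11-false∷ u)))) ⟩
  edgeCountΓ̄ n + vertexCount n + edgeCountQ n ∎

edgeCountΓ̄-recurrence : ∀ m → edgeCountΓ̄ (3 + m) + fib (5 + m)
                            ≡ edgeCountΓ̄ (2 + m) + edgeCountΓ̄ (1 + m) + (m + 7) * 2 ^ m
edgeCountΓ̄-recurrence m = begin
  e₃ + fib (5 + m)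
    ≡⟨ cong (_+ fib (5 + m)) (trans (edgeCountΓ̄-suc (2 + m)) (cong (e₂ + g₂ +_) (edgeCount1Γ̄-suc (1 + m)))) ⟩
  e₂ + g₂ + (e₁ + g₁ + edgeCountQ (1 + m)) + (fib (4 + m) + fib (3 + m))
    ≡⟨ cong (λ q → e₂ + g₂ + (e₁ + g₁ + q) + (fib (4 + m) + fib (3 + m))) (edgeCountQ-suc m) ⟩
  e₂ + g₂ + (e₁ + g₁ + (1 + m) * 2 ^ m) + (fib (4 + m) + fib (3 + m))
    ≡⟨ regroup e₂ g₂ e₁ g₁ (2 ^ m) (fib (4 + m)) (fib (3 + m)) m ⟩
  e₂ + e₁ + (g₂ + fib (4 + m)) + (g₁ + fib (3 + m)) + (1 + m) * 2 ^ m
    ≡⟨ cong₂ (λ a b → e₂ + e₁ + a + b + (1 + m) * 2 ^ m) (vertexCount+fib (2 + m)) (vertexCount+fib (1 + m)) ⟩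
  e₂ + e₁ + 2 ^ (2 + m) + 2 ^ (1 + m) + (1 + m) * 2 ^ m
    ≡⟨ collect e₂ e₁ (2 ^ m) m ⟩
  e₂ + e₁ + (m + 7) * 2 ^ m ∎
  where
  e₃ = edgeCountΓ̄ (3 + m)
  e₂ = edgeCountΓ̄ (2 + m)
  e₁ = edgeCountΓ̄ (1 + m)
  g₂ = vertexCount (2 + m)
  g₁ = vertexCount (1 + m)
  regroup : ∀ a b c d p x y m → a + b + (c + d + (1 + m) * p) + (x + y)
                               ≡ a + c + (b + x) + (d + y) + (1 + m) * p
  regroup = solve-∀
  collect : ∀ a c p m → a + c + 2 * (2 * p) + 2 * p + (1 + m) * p ≡ a + c + (m + 7) * p
  collect = solve-∀

mainTheorem15 : (numEdges 1 ≡ 0) × (numEdges 2 ≡ 0)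
    × ((m : ℕ) → numEdges (m + 3) + fib (m + 5)
        ≡ numEdges (m + 2) + numEdges (m + 1) + (m + 7) * 2 ^ m)
mainTheorem15 = refl , refl , recurrence
  where
  recurrence : (m : ℕ) → numEdges (m + 3) + fib (m + 5)
                         ≡ numEdges (m + 2) + numEdges (m + 1) + (m + 7) * 2 ^ m
  recurrence m
    rewrite +-comm m 3 | +-comm m 5 | +-comm m 2 | +-comm m 1
          | numEdges≡edgeCount (3 + m) | numEdges≡edgeCount (2 + m) | numEdges≡edgeCount (1 + m)
    = edgeCountΓ̄-recurrence m
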